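{- For every integer $n\ge 1$, $$H_n(x)=\sum_{i=1}^{n}\frac{(2i-1)x-(i-1)}{i}\,H_{i-1}(x)\,H_{n-i}(x),$$ where $H_0(x)=1$ and for $j\ge1$, $H_j(x)=\sum_{F\in\mathcal{F}(j)}\prod_{v\in V(F)}\frac{(2h_v-1)x+1-h_v}{h_v}$.
   Context: A plane tree is a rooted tree with unlabelled vertices in which the children of each vertex are linearly ordered. A plane forest is a linearly ordered sequence of plane trees; $\mathcal{F}(j)$ is the set of plane forests with $j$ vertices in total. $V(F)$ is the vertex set of $F$, and for $v\in V(F)$ the hook length $h_v$ is the number of vertices in the subtree rooted at $v$ (including $v$). -}

module Defs where

open import Data.Nat using (ℕ; zero; suc; _∸_)
import Data.Nat as ℕ
open import Data.Integer using (+_)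
open import Data.List using (List; []; _∷_; map; upTo; foldr)
open import Data.List.Membership.Propositional using (_∈_)
open import Data.List.Relation.Unary.Unique.Propositional using (Unique)
open import Data.Product using (_×_)
open import Relation.Binary.PropositionalEquality using (_≡_)
open import Data.Rational using (ℚ; _/_; 0ℚ; 1ℚ; _+_; _*_; _-_)

data Tree : Set where
  node : List Tree → Tree

Forest : Set
Forest = List Tree

mutual
  sizeT : Tree → ℕ
  sizeT (node ts) = suc (sizeF ts)

  sizeF : Forest → ℕ
  sizeF []       = 0
  sizeF (t ∷ ts) = sizeT t ℕ.+ sizeF ts

ℕ→ℚ : ℕ → ℚ
ℕ→ℚ n = + n / 1

wt : ℚ → ℕ → ℚ
wt x zero    = 0ℚ   -- never used: hook lengths are ≥ 1
wt x (suc k) = (((ℕ→ℚ 2 * ℕ→ℚ (suc k) - 1ℚ) * x + 1ℚ) - ℕ→ℚ (suc k)) * (+ 1 / suc k)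

mutual
  -- product over all vertices v of the tree of wt x h_v
  -- (the hook length of the root of node ts is sizeT (node ts))
  prodT : ℚ → Tree → ℚ
  prodT x (node ts) = wt x (sizeT (node ts)) * prodF x ts

  prodF : ℚ → Forest → ℚ
  prodF x []       = 1ℚ
  prodF x (t ∷ ts) = prodT x t * prodF x ts

sumℚ : List ℚ → ℚ
sumℚ = foldr _+_ 0ℚ

-- enum is an enumeration of the plane forests: enum j lists every forest
-- with exactly j vertices, each exactly once (so it represents 𝓕(j)).
IsForestEnum : (ℕ → List Forest) → Set
IsForestEnum enum =
  ((j : ℕ) (F : Forest) → (F ∈ enum j → sizeF F ≡ j) × (sizeF F ≡ j → F ∈ enum j))
  × ((j : ℕ) → Unique (enum j))

H : (ℕ → List Forest) → ℚ → ℕ → ℚ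
H enum x zero    = 1ℚ
H enum x (suc j) = sumℚ (map (prodF x) (enum (suc j)))

recTerm : (ℕ → List Forest) → ℚ → ℕ → ℕ → ℚ
recTerm enum x n k =
  (((ℕ→ℚ 2 * ℕ→ℚ (suc k) - 1ℚ) * x - ℕ→ℚ k) * (+ 1 / suc k))
    * H enum x k * H enum x (n ∸ suc k)

-- the right-hand side: k ranges over 0 … n-1, i.e. i = k+1 over 1 … n
recRHS : (ℕ → List Forest) → ℚ → ℕ → ℚ
recRHS enum x n = sumℚ (map (recTerm enum x n) (upTo n))

-- Cut a forest on n vertices into its first tree and the remaining forest. If the first
-- tree has i vertices, its root has hook length i and weight ((2i-1)x+1-i)/i, which is the
-- i-th coefficient of the recurrence; its subtrees form an arbitrary forest on i-1 vertices
-- and the remaining trees an arbitrary forest on n-i vertices, with the hook lengths inside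
-- both unchanged. Summing the weight products over this bijection gives the recurrence.
-- Since H does not depend on the order of the enumeration, it may be computed along an
-- explicit enumeration organised by the size of the first tree.
module Submission where

open import Defs
open import Data.Nat using (ℕ; _≤_)
open import Data.List using (List)
open import Data.Rational using (ℚ)
open import Relation.Binary.PropositionalEquality using (_≡_)

open import Data.Nat using (zero; suc; _<_; _∸_; s≤s)
import Data.Nat as ℕ
import Data.Nat.Properties as ℕ
open import Data.Nat.Coprimality using (1-coprimeTo) renaming (sym to coprime-sym)
open import Data.Integer using (+_; _◃_)
import Data.Integer as ℤ
import Data.Integer.Properties as ℤ
open import Data.Sign using (Sign)
open import Data.Rational using (mkℚ; _+_; _*_; _-_; _/_; 1ℚ)
open import Data.Rational.Properties
  using (↥p/↧p≡p; +-assoc; +-identityˡ; +-identityʳ; +-0-isCommutativeMonoid;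
         *-zeroˡ; *-zeroʳ; *-distribˡ-+; *-distribʳ-+)
open import Data.Rational.Solver using (module +-*-Solver)
open import Data.List using ([]; _∷_; [_]; map; _++_; concatMap; cartesianProductWith; upTo)
open import Data.List.Properties using (map-∘)
open import Data.List.Membership.Propositional using (_∈_)
open import Data.List.Membership.Propositional.Properties
  using (∈-concat⁻′; ∈-concat⁺′; ∈-map⁻; ∈-map⁺;
         ∈-cartesianProductWith⁻; ∈-cartesianProductWith⁺; ∈-upTo⁻; ∈-upTo⁺)
open import Data.List.Membership.Propositional.Properties.WithK using (unique∧set⇒bag)
open import Data.List.Relation.Binary.BagAndSetEquality using (∼bag⇒↭)
open import Data.List.Relation.Binary.Disjoint.Propositional using (Disjoint)
open import Data.List.Relation.Binary.Permutation.Propositional using (_↭_; ↭⇒↭ₛ)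
import Data.List.Relation.Binary.Permutation.Propositional.Properties as ↭
import Data.List.Relation.Binary.Permutation.Setoid.Properties as ↭ₛ
open import Data.List.Relation.Unary.Any using (here; there)
import Data.List.Relation.Unary.All as All
import Data.List.Relation.Unary.All.Properties as All
import Data.List.Relation.Unary.AllPairs as AllPairs
import Data.List.Relation.Unary.AllPairs.Properties as AllPairs
open import Data.List.Relation.Unary.Unique.Propositional using (Unique)
import Data.List.Relation.Unary.Unique.Propositional.Properties as Unique
open import Data.Product using (_×_; _,_; proj₁; proj₂)
open import Function using (_∘_)
open import Function.Bundles using (mk⇔)
open import Relation.Nullary using (¬_)
open import Relation.Binary.PropositionalEquality
  using (refl; sym; trans; cong; cong₂; subst; setoid; module ≡-Reasoning)

private
  variable
    A B C : Set

1+ℕ→ℚ : ∀ k → 1ℚ + ℕ→ℚ k ≡ ℕ→ℚ (suc k)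
1+ℕ→ℚ k =
  -- once ℕ→ℚ k is written in normal form the addition computes, up to k * 1 ≡ k
  trans (cong (λ q → 1ℚ + q) (↥p/↧p≡p (mkℚ (+ k) 0 (coprime-sym (1-coprimeTo k)))))
        (cong (λ i → (+ 1 ℤ.+ i) / 1) (trans (cong (Sign.+ ◃_) (ℕ.*-identityʳ k)) (ℤ.+◃n≡+n k)))

wt-suc : ∀ x k →
  wt x (suc k) ≡ ((ℕ→ℚ 2 * ℕ→ℚ (suc k) - 1ℚ) * x - ℕ→ℚ k) * (+ 1 / suc k)
wt-suc x k = cong (_* (+ 1 / suc k)) (begin
  (a + 1ℚ) - ℕ→ℚ (suc k)     ≡⟨ cong ((a + 1ℚ) -_) (sym (1+ℕ→ℚ k)) ⟩
  (a + 1ℚ) - (1ℚ + ℕ→ℚ k)    ≡⟨ cancel a (ℕ→ℚ k) ⟩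
  a - ℕ→ℚ k                  ∎)
  where
  open ≡-Reasoning
  open +-*-Solver
  a = (ℕ→ℚ 2 * ℕ→ℚ (suc k) - 1ℚ) * x
  cancel : ∀ a c → (a + 1ℚ) - (1ℚ + c) ≡ a - c
  cancel = solve 2 (λ a c → (a :+ con 1ℚ) :- (con 1ℚ :+ c) := a :- c) refl

recTerm-wt : ∀ enum x n k →
  recTerm enum x n k ≡ wt x (suc k) * H enum x k * H enum x (n ∸ suc k)
recTerm-wt enum x n k =
  cong (λ c → c * H enum x k * H enum x (n ∸ suc k)) (sym (wt-suc x k))

sumℚ-map-++ : (f : A → ℚ) (xs ys : List A) →
  sumℚ (map f (xs ++ ys)) ≡ sumℚ (map f xs) + sumℚ (map f ys)
sumℚ-map-++ f [] ys = sym (+-identityˡ _)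
sumℚ-map-++ f (x ∷ xs) ys =
  trans (cong (λ s → f x + s) (sumℚ-map-++ f xs ys)) (sym (+-assoc (f x) _ _))

sumℚ-map-concatMap : (f : B → ℚ) (g : A → List B) (xs : List A) →
  sumℚ (map f (concatMap g xs)) ≡ sumℚ (map (λ x → sumℚ (map f (g x))) xs)
sumℚ-map-concatMap f g [] = refl
sumℚ-map-concatMap f g (x ∷ xs) =
  trans (sumℚ-map-++ f (g x) (concatMap g xs))
        (cong (λ s → sumℚ (map f (g x)) + s) (sumℚ-map-concatMap f g xs))

sumℚ-map-cartesianProductWith : (f : C → ℚ) (g : A → B → C) (xs : List A) (ys : List B) →
  sumℚ (map f (cartesianProductWith g xs ys)) ≡ sumℚ (map (λ x → sumℚ (map (f ∘ g x) ys)) xs)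
sumℚ-map-cartesianProductWith f g [] ys = refl
sumℚ-map-cartesianProductWith f g (x ∷ xs) ys = begin
  sumℚ (map f (map (g x) ys ++ cartesianProductWith g xs ys))
    ≡⟨ sumℚ-map-++ f (map (g x) ys) _ ⟩
  sumℚ (map f (map (g x) ys)) + sumℚ (map f (cartesianProductWith g xs ys))
    ≡⟨ cong₂ _+_ (cong sumℚ (sym (map-∘ ys))) (sumℚ-map-cartesianProductWith f g xs ys) ⟩
  sumℚ (map (f ∘ g x) ys) + sumℚ (map (λ x → sumℚ (map (f ∘ g x) ys)) xs)
    ∎
  where open ≡-Reasoning

sumℚ-map-*ˡ : (c : ℚ) (f : A → ℚ) (xs : List A) →
  sumℚ (map (λ x → c * f x) xs) ≡ c * sumℚ (map f xs)
sumℚ-map-*ˡ c f [] = sym (*-zeroʳ c)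
sumℚ-map-*ˡ c f (x ∷ xs) =
  trans (cong (λ s → c * f x + s) (sumℚ-map-*ˡ c f xs)) (sym (*-distribˡ-+ c (f x) _))

sumℚ-map-*ʳ : (c : ℚ) (f : A → ℚ) (xs : List A) →
  sumℚ (map (λ x → f x * c) xs) ≡ sumℚ (map f xs) * c
sumℚ-map-*ʳ c f [] = sym (*-zeroˡ c)
sumℚ-map-*ʳ c f (x ∷ xs) =
  trans (cong (λ s → f x * c + s) (sumℚ-map-*ʳ c f xs)) (sym (*-distribʳ-+ c (f x) _))

sumℚ-map-cong : {f g : A → ℚ} (xs : List A) → (∀ {x} → x ∈ xs → f x ≡ g x) →
  sumℚ (map f xs) ≡ sumℚ (map g xs)
sumℚ-map-cong [] f≡g = refl
sumℚ-map-cong (x ∷ xs) f≡g = cong₂ _+_ (f≡g (here refl)) (sumℚ-map-cong xs (f≡g ∘ there))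

sumℚ-↭ : {xs ys : List ℚ} → xs ↭ ys → sumℚ xs ≡ sumℚ ys
sumℚ-↭ = ↭ₛ.foldr-commMonoid (setoid ℚ) +-0-isCommutativeMonoid ∘ ↭⇒↭ₛ

sumℚ-map-unique : (f : A → ℚ) {xs ys : List A} → Unique xs → Unique ys →
  (∀ {z} → z ∈ xs → z ∈ ys) → (∀ {z} → z ∈ ys → z ∈ xs) →
  sumℚ (map f xs) ≡ sumℚ (map f ys)
sumℚ-map-unique f xs! ys! xs⊆ys ys⊆xs =
  sumℚ-↭ (↭.map⁺ f (∼bag⇒↭ (unique∧set⇒bag xs! ys! (mk⇔ xs⊆ys ys⊆xs))))

plant : Forest → Forest → Forest
plant ts F = node ts ∷ F

plant-injective : ∀ {ts ts′ F F′} → plant ts F ≡ plant ts′ F′ → ts ≡ ts′ × F ≡ F′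
plant-injective refl = refl , refl

-- The first argument is fuel: forests fuel j enumerates 𝓕(j) whenever j < fuel.
mutual
  forests : ℕ → ℕ → List Forest
  forests zero    j       = []
  forests (suc f) zero    = [ [] ]
  forests (suc f) (suc n) = concatMap (withFirstTree f n) (upTo (suc n))

  withFirstTree : ℕ → ℕ → ℕ → List Forest
  withFirstTree f n k = cartesianProductWith plant (forests f k) (forests f (n ∸ k))

∈-forests⇒sizeF : ∀ f j {F} → F ∈ forests f j → sizeF F ≡ j
∈-forests⇒sizeF (suc f) zero (here refl) = refl
∈-forests⇒sizeF (suc f) (suc n) F∈
  with _ , F∈block , block∈ ← ∈-concat⁻′ (map (withFirstTree f n) (upTo (suc n))) F∈
  with k , k∈ , refl ← ∈-map⁻ (withFirstTree f n) block∈
  with ts , rest , ts∈ , rest∈ , refl ← ∈-cartesianProductWith⁻ plant (forests f k) _ F∈block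
  = cong suc (trans (cong₂ ℕ._+_ (∈-forests⇒sizeF f k ts∈) (∈-forests⇒sizeF f (n ∸ k) rest∈))
                    (ℕ.m+[n∸m]≡n (ℕ.≤-pred (∈-upTo⁻ k∈))))

sizeF<⇒∈-forests : ∀ f F → sizeF F < f → F ∈ forests f (sizeF F)
sizeF<⇒∈-forests (suc f) []                 _        = here refl
sizeF<⇒∈-forests (suc f) (node ts ∷ rest) (s≤s F<f) =
  ∈-concat⁺′
    (∈-cartesianProductWith⁺ plant (sizeF<⇒∈-forests f ts ts<f)
      (subst (λ r → rest ∈ forests f r) (sym (ℕ.m+n∸m≡n k r)) (sizeF<⇒∈-forests f rest rest<f)))
    (∈-map⁺ (withFirstTree f (k ℕ.+ r)) (∈-upTo⁺ (s≤s (ℕ.m≤m+n k r))))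
  where
  k = sizeF ts
  r = sizeF rest
  ts<f : k < f
  ts<f = ℕ.<-≤-trans (s≤s (ℕ.m≤m+n k r)) F<f
  rest<f : r < f
  rest<f = ℕ.<-≤-trans (s≤s (ℕ.m≤n+m r k)) F<f

withFirstTree-disjoint : ∀ f n {k k′} → ¬ k ≡ k′ →
  Disjoint (withFirstTree f n k) (withFirstTree f n k′)
withFirstTree-disjoint f n {k} {k′} k≢k′ (F∈ , F∈′)
  with ts , _ , ts∈ , _ , refl ← ∈-cartesianProductWith⁻ plant (forests f k) _ F∈
  with ts′ , _ , ts∈′ , _ , F≡ ← ∈-cartesianProductWith⁻ plant (forests f k′) _ F∈′
  = k≢k′ (trans (sym (∈-forests⇒sizeF f k ts∈))
                (subst (λ t → sizeF t ≡ k′) (sym (proj₁ (plant-injective F≡))) (∈-forests⇒sizeF f k′ ts∈′)))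

forests-unique : ∀ f j → Unique (forests f j)
forests-unique zero    j       = AllPairs.[]
forests-unique (suc f) zero    = All.[] AllPairs.∷ AllPairs.[]
forests-unique (suc f) (suc n) = Unique.concat⁺
  (All.map⁺ (All.tabulate λ {k} _ →
    Unique.cartesianProductWith⁺ plant plant-injective (forests-unique f k) (forests-unique f (n ∸ k))))
  (AllPairs.map⁺ (AllPairs.map (withFirstTree-disjoint f n) (Unique.upTo⁺ (suc n))))

sum-prodF-withFirstTree : ∀ x f n k →
  sumℚ (map (prodF x) (withFirstTree f n k))
    ≡ wt x (suc k) * sumℚ (map (prodF x) (forests f k)) * sumℚ (map (prodF x) (forests f (n ∸ k)))
sum-prodF-withFirstTree x f n k = begin
  sumℚ (map P (cartesianProductWith plant As Bs))
    ≡⟨ sumℚ-map-cartesianProductWith P plant As Bs ⟩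
  sumℚ (map (λ ts → sumℚ (map (λ F → prodT x (node ts) * P F) Bs)) As)
    ≡⟨ sumℚ-map-cong As (λ {ts} _ → sumℚ-map-*ˡ (prodT x (node ts)) P Bs) ⟩
  sumℚ (map (λ ts → wt x (suc (sizeF ts)) * P ts * S Bs) As)
    ≡⟨ sumℚ-map-cong As (λ ts∈ → cong (λ h → wt x (suc h) * _ * S Bs) (∈-forests⇒sizeF f k ts∈)) ⟩
  sumℚ (map (λ ts → wt x (suc k) * P ts * S Bs) As)
    ≡⟨ sumℚ-map-*ʳ (S Bs) (λ ts → wt x (suc k) * P ts) As ⟩
  sumℚ (map (λ ts → wt x (suc k) * P ts) As) * S Bs
    ≡⟨ cong (_* S Bs) (sumℚ-map-*ˡ (wt x (suc k)) P As) ⟩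
  wt x (suc k) * S As * S Bs
    ∎
  where
  open ≡-Reasoning
  P = prodF x
  S = sumℚ ∘ map P
  As = forests f k
  Bs = forests f (n ∸ k)

H≡sum-prodF-forests : ∀ enum → IsForestEnum enum → ∀ x f j → j < f →
  H enum x j ≡ sumℚ (map (prodF x) (forests f j))
H≡sum-prodF-forests enum isEnum x (suc f) zero    _   = sym (+-identityʳ 1ℚ)
H≡sum-prodF-forests enum isEnum x f       (suc j) j<f =
  sumℚ-map-unique (prodF x) (proj₂ isEnum (suc j)) (forests-unique f (suc j)) enum⊆forests forests⊆enum
  where
  enum⊆forests : ∀ {F} → F ∈ enum (suc j) → F ∈ forests f (suc j)
  enum⊆forests {F} F∈ = subst (λ m → F ∈ forests f m) size≡
    (sizeF<⇒∈-forests f F (subst (_< f) (sym size≡) j<f))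
    where size≡ = proj₁ (proj₁ isEnum (suc j) F) F∈
  forests⊆enum : ∀ {F} → F ∈ forests f (suc j) → F ∈ enum (suc j)
  forests⊆enum {F} F∈ = proj₂ (proj₁ isEnum (suc j) F) (∈-forests⇒sizeF f (suc j) F∈)

sum-prodF-withFirstTree≡recTerm : ∀ enum → IsForestEnum enum → ∀ x n k → k < suc n →
  sumℚ (map (prodF x) (withFirstTree (suc n) n k)) ≡ recTerm enum x (suc n) k
sum-prodF-withFirstTree≡recTerm enum isEnum x n k k<1+n = begin
  sumℚ (map (prodF x) (withFirstTree (suc n) n k))
    ≡⟨ sum-prodF-withFirstTree x (suc n) n k ⟩
  wt x (suc k) * Sf k * Sf (n ∸ k)
    ≡⟨ cong₂ (λ a b → wt x (suc k) * a * b) (H≡ k<1+n) (H≡ (s≤s (ℕ.m∸n≤m n k))) ⟨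
  wt x (suc k) * H enum x k * H enum x (n ∸ k)
    ≡⟨ recTerm-wt enum x (suc n) k ⟨
  recTerm enum x (suc n) k
    ∎
  where
  open ≡-Reasoning
  Sf : ℕ → ℚ
  Sf j = sumℚ (map (prodF x) (forests (suc n) j))
  H≡ : ∀ {j} → j < suc n → H enum x j ≡ Sf j
  H≡ = H≡sum-prodF-forests enum isEnum x (suc n) _

lemma4p2 : (enum : ℕ → List Forest) → IsForestEnum enum →
    (n : ℕ) → 1 ≤ n → (x : ℚ) → H enum x n ≡ recRHS enum x n
lemma4p2 enum isEnum (suc n) _ x = begin
  H enum x (suc n)
    ≡⟨ H≡sum-prodF-forests enum isEnum x (suc (suc n)) (suc n) ℕ.≤-refl ⟩
  sumℚ (map (prodF x) (concatMap (withFirstTree (suc n) n) (upTo (suc n))))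
    ≡⟨ sumℚ-map-concatMap (prodF x) (withFirstTree (suc n) n) (upTo (suc n)) ⟩
  sumℚ (map (λ k → sumℚ (map (prodF x) (withFirstTree (suc n) n k))) (upTo (suc n)))
    ≡⟨ sumℚ-map-cong (upTo (suc n)) (sum-prodF-withFirstTree≡recTerm enum isEnum x n _ ∘ ∈-upTo⁻) ⟩
  recRHS enum x (suc n)
    ∎
  where open ≡-Reasoning
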